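{- Let $G$ be a resolution dag (RD) proof of size $s$ of the clause $C$ from the set $F$ of clauses, and let $d$ be the depth of (the node labeled) $C$ in $G$. Then there is an RTI proof $T$ of $C$ from $F$ of size $<2sd$. If $G$ is regular then $T$ is also regular.
   Context: Clauses are finite sets of literals. Resolution: from $C_0\ni x$ and $C_1\ni\overline x$ infer $(C_0\setminus\{x\})\cup(C_1\setminus\{\overline x\})$. An RD proof of $C$ from $F$ is a finite dag of clause-labeled nodes with a unique out-degree-$0$ node labeled $C$; in-degree-$0$ nodes are labeled by clauses of $F$; every other node has in-degree $2$, is labeled by a variable $x$ and by the resolvent on $x$ of its predecessors' clauses. Size = number of nodes. The depth of a node is the maximum number of edges on a path from an in-degree-$0$ node to it. An RD is regular if for every variable $x$ every path contains at most one node labeled $x$. An RTL proof of $D$ from $F$ is an ordered binary tree $T$ with post-order $<_T$ (nodes of the left subtree of $u$ precede nodes of the right subtree of $u$, which precede $u$) in which each leaf $v$ is labeled by a clause of $F$ or by a clause labeling some node $u<_T v$ (a lemma), each internal node is labeled by a variable $x$ and the clause inferred by resolution on $x$ from the clauses of its two children, and the root is labeled $D$. An input resolution tree is a resolution tree in which every internal node has at least one child that is a leaf. A node $v$ of $T$ is input-derived if the subtree of $T$ rooted at $v$ is an input resolution tree. An RTI proof is an RTL proof in which every leaf $v$ not labeled by a clause of $F$ is labeled by a clause labeling some input-derived node $u<_T v$. An RTI proof is regular if no path from a leaf to the root contains two nodes whose resolution inferences use the same variable. Size = number of nodes. -}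

module Defs where

open import Data.Nat using (ℕ; zero; suc; _≤_; _<_)
open import Data.Fin as Fin using (Fin; fromℕ)
open import Data.List using (List; length; []; _∷_; _++_; [_])
import Data.List as List
open import Data.List.Membership.Propositional using (_∈_)
open import Data.List.Relation.Unary.Any using (Any)
open import Data.Product using (Σ; ∃; _×_)
open import Data.Sum using (_⊎_)
open import Data.Unit using (⊤)
open import Data.Empty using (⊥)
open import Data.Maybe using (Maybe; just; nothing)
open import Relation.Binary.PropositionalEquality using (_≡_; _≢_)

data Lit : Set where
  pos : ℕ → Lit
  neg : ℕ → Lit

-- A clause is a finite set of literals, represented by a list;
-- clauses are compared extensionally (as sets).
Clause : Set
Clause = List Lit

_≈_ : Clause → Clause → Set
A ≈ B = ∀ l → (l ∈ A → l ∈ B) × (l ∈ B → l ∈ A)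

InF : List Clause → Clause → Set
InF F D = Any (D ≈_) F

ResolventPN : ℕ → Clause → Clause → Clause → Set
ResolventPN v C₀ C₁ R =
  pos v ∈ C₀ × neg v ∈ C₁ ×
  (∀ l → (l ∈ R → (l ∈ C₀ × l ≢ pos v) ⊎ (l ∈ C₁ × l ≢ neg v))
       × ((l ∈ C₀ × l ≢ pos v) ⊎ (l ∈ C₁ × l ≢ neg v) → l ∈ R))

Resolves : ℕ → Clause → Clause → Clause → Set
Resolves v A B R = ResolventPN v A B R ⊎ ResolventPN v B A R

-- A node of a dag with s nodes (nodes are Fin s, in a topological order):
-- either an in-degree-0 node labelled by a clause, or an in-degree-2 node
-- labelled by a variable, its two predecessors and a clause.
data Node (s : ℕ) : Set where
  leaf  : Clause → Node s
  inner : ℕ → Fin s → Fin s → Clause → Node s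

clauseOf : ∀ {s} → Node s → Clause
clauseOf (leaf D) = D
clauseOf (inner _ _ _ D) = D

varOf : ∀ {s} → Node s → Maybe ℕ
varOf (leaf _) = nothing
varOf (inner x _ _ _) = just x

Dag : ℕ → Set
Dag s = Fin s → Node s

Edge : ∀ {s} → Dag s → Fin s → Fin s → Set
Edge {s} g u w = Σ ℕ λ x → Σ (Fin s) λ i → Σ (Fin s) λ j → Σ Clause λ D →
  g w ≡ inner x i j D × (u ≡ i ⊎ u ≡ j)

data Path {s} (g : Dag s) : Fin s → Fin s → ℕ → Set where
  here : ∀ {u} → Path g u u 0
  step : ∀ {u v w n} → Path g u v n → Edge g v w → Path g u w (suc n)

IsSource : ∀ {s} → Dag s → Fin s → Set
IsSource g u = Σ Clause λ D → g u ≡ leaf D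

-- An RD proof of C from F with suc m nodes; its unique out-degree-0 node
-- is the last node  fromℕ m  (w.l.o.g. by the topological ordering).
record RD (F : List Clause) (C : Clause) : Set where
  field
    m       : ℕ
    node    : Dag (suc m)
    leafOK  : ∀ k D → node k ≡ leaf D → InF F D
    innerOK : ∀ k x i j D → node k ≡ inner x i j D →
              i Fin.< k × j Fin.< k × i ≢ j ×
              Resolves x (clauseOf (node i)) (clauseOf (node j)) D
    rootOK  : clauseOf (node (fromℕ m)) ≈ C
    sinkOK  : ∀ k → k ≢ fromℕ m → Σ (Fin (suc m)) λ k' → Edge node k k'

  root : Fin (suc m)
  root = fromℕ m

  size : ℕ
  size = suc m

open RD public

IsDepth : ∀ {F C} (G : RD F C) → Fin (size G) → ℕ → Set
IsDepth G v d =
  (Σ (Fin (size G)) λ u → IsSource (node G) u × Path (node G) u v d) ×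
  (∀ u n → IsSource (node G) u → Path (node G) u v n → n ≤ d)

RegularRD : ∀ {F C} → RD F C → Set
RegularRD G = ∀ u v n x → Path (node G) u v (suc n) →
  varOf (node G u) ≡ just x → varOf (node G v) ≡ just x → ⊥

data Tree : Set where
  tleaf : Clause → Tree
  tnode : ℕ → Clause → Tree → Tree → Tree

labelT : Tree → Clause
labelT (tleaf D) = D
labelT (tnode _ D _ _) = D

postorder : Tree → List Tree
postorder (tleaf D) = [ tleaf D ]
postorder (tnode x D l r) = postorder l ++ postorder r ++ [ tnode x D l r ]

sizeT : Tree → ℕ
sizeT t = length (postorder t)

Inferences : Tree → Set
Inferences (tleaf _) = ⊤
Inferences (tnode x D l r) =
  Resolves x (labelT l) (labelT r) D × Inferences l × Inferences r

IsLeaf : Tree → Set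
IsLeaf (tleaf _) = ⊤
IsLeaf (tnode _ _ _ _) = ⊥

IsInput : Tree → Set
IsInput (tleaf _) = ⊤
IsInput (tnode _ _ l r) = (IsLeaf l ⊎ IsLeaf r) × IsInput l × IsInput r

-- RTI proof of D from F: every leaf v is labelled by a clause of F or by
-- the clause of an input-derived node u <_T v (positions in post-order).
IsRTI : List Clause → Clause → Tree → Set
IsRTI F D t =
  Inferences t × labelT t ≈ D ×
  (∀ (p : Fin (sizeT t)) E → List.lookup (postorder t) p ≡ tleaf E →
     InF F E ⊎
     (Σ (Fin (sizeT t)) λ q → q Fin.< p ×
        labelT (List.lookup (postorder t) q) ≈ E ×
        IsInput (List.lookup (postorder t) q)))

NoVar : ℕ → Tree → Set
NoVar x (tleaf _) = ⊤
NoVar x (tnode y _ l r) = y ≢ x × NoVar x l × NoVar x r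

-- regular: no leaf-to-root path has two inferences on the same variable,
-- i.e. no internal node has a descendant inference on its own variable
RegularT : Tree → Set
RegularT (tleaf _) = ⊤
RegularT (tnode x _ l r) = NoVar x l × NoVar x r × RegularT l × RegularT r

-- Unfold the dag depth-first from its root into a tree, but stop at sources and at nodes
-- whose clause already labels an earlier input subtree; those become leaves.  Count the
-- unfoldings of each node.  A child that is not yet available is unfolded during every
-- unfolding of its parent, so its count never falls behind the parent's.  Hence when v
-- is unfolded for the height(v)-th time both children are available, the subtree for v
-- is one inference from two leaves, i.e. an input tree, and v is never unfolded again.
-- So every node is unfolded at most height ≤ d times (the source 0 never), each
-- unfolding adds two tree nodes, and the tree has at most 2(s−1)d + 1 < 2sd nodes.
-- Tree paths follow dag paths, which transfers regularity.
module Submission where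

open import Defs
open import Level using (0ℓ)
open import Function using (_∘_; id)
open import Data.Nat using (ℕ; zero; suc; _+_; _*_; _⊔_; _≤_; _<_; z≤n; s≤s)
open import Data.Nat.Properties
  using (≤-refl; ≤-trans; ≤-reflexive; ≤-pred; <⇒≤; n≤1+n; n<1+n; +-suc; +-assoc; +-comm;
         +-identityʳ; +-mono-≤; *-monoʳ-≤; ≰⇒>; ⊔-sel; m≤m⊔n; m≤n⊔m; m⊔n≤o⇒m≤o; m⊔n≤o⇒n≤o;
         +-0-monoid; module ≤-Reasoning)
  renaming (_≟_ to _≟ℕ_)
open import Data.Nat.Tactic.RingSolver using (solve-∀)
open import Data.Fin as Fin using (Fin; zero; suc; toℕ)
open import Data.Fin.Properties using (_≟_; <-trans; <⇒≢; toℕ<n)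
open import Data.Fin.Induction using (<-wellFounded)
open import Data.Vec.Functional using (Vector; tail; updateAt)
open import Data.Vec.Functional.Properties using (updateAt-updates; updateAt-minimal)
open import Algebra.Properties.Monoid.Sum +-0-monoid using (sum; sum-replicate-zero)
open import Data.List using (List; []; _∷_; _++_; [_]; length; take; lookup)
open import Data.List.Properties using (++-assoc; ++-identityʳ; length-++; ≡-dec)
open import Data.List.Relation.Unary.Any using (Any; here; there; any?)
import Data.List.Relation.Unary.Any as Any
open import Data.List.Relation.Unary.Any.Properties using (++⁺ˡ; ++⁺ʳ)
open import Data.Product using (Σ; _×_; _,_; proj₁; proj₂; map₂)
open import Data.Sum using (_⊎_; inj₁; inj₂)
open import Data.Unit using (⊤; tt)
open import Data.Empty using (⊥-elim)
open import Data.Maybe using (just)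
open import Induction.WellFounded using (module All)
open import Relation.Nullary using (¬_; Dec; yes; no; contradiction)
open import Relation.Nullary.Decidable using (map′; _×-dec_; _⊎-dec_)
open import Relation.Binary.Definitions using (DecidableEquality)
open import Relation.Binary.PropositionalEquality
  using (_≡_; _≢_; refl; sym; trans; cong; cong₂; subst; subst₂; ≢-sym; module ≡-Reasoning)

_≟ᴸ_ : DecidableEquality Lit
pos x ≟ᴸ pos y = map′ (cong pos) (λ { refl → refl }) (x ≟ℕ y)
neg x ≟ᴸ neg y = map′ (cong neg) (λ { refl → refl }) (x ≟ℕ y)
pos _ ≟ᴸ neg _ = no λ ()
neg _ ≟ᴸ pos _ = no λ ()

_≟ᶜ_ : DecidableEquality Clause
_≟ᶜ_ = ≡-dec _≟ᴸ_

≡⇒≈ : ∀ {A B} → A ≡ B → A ≈ B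
≡⇒≈ refl _ = id , id

internals : Tree → ℕ
internals (tleaf _) = 0
internals (tnode _ _ l r) = suc (internals l + internals r)

sizeT≡2*internals+1 : ∀ t → sizeT t ≡ 2 * internals t + 1
sizeT≡2*internals+1 (tleaf _) = refl
sizeT≡2*internals+1 t@(tnode _ _ l r) = begin
  length (postorder l ++ postorder r ++ [ t ])   ≡⟨ length-++ (postorder l) ⟩
  sizeT l + length (postorder r ++ [ t ])        ≡⟨ cong (sizeT l +_) (length-++ (postorder r)) ⟩
  sizeT l + (sizeT r + 1)                        ≡⟨ cong₂ (λ a b → a + (b + 1))
                                                      (sizeT≡2*internals+1 l) (sizeT≡2*internals+1 r) ⟩
  (2 * a + 1) + ((2 * b + 1) + 1)                ≡⟨ regroup a b ⟩
  2 * suc (a + b) + 1                            ∎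
  where
  open ≡-Reasoning
  a = internals l
  b = internals r
  regroup : ∀ a b → (2 * a + 1) + ((2 * b + 1) + 1) ≡ 2 * suc (a + b) + 1
  regroup = solve-∀

isLeaf? : ∀ t → Dec (IsLeaf t)
isLeaf? (tleaf _) = yes tt
isLeaf? (tnode _ _ _ _) = no λ ()

isInput? : ∀ t → Dec (IsInput t)
isInput? (tleaf _) = yes tt
isInput? (tnode _ _ l r) = (isLeaf? l ⊎-dec isLeaf? r) ×-dec (isInput? l ×-dec isInput? r)

IsLeaf⇒IsInput : ∀ t → IsLeaf t → IsInput t
IsLeaf⇒IsInput (tleaf _) _ = tt

InputDerived : List Tree → Clause → Set
InputDerived ts E = Any (λ t → IsInput t × labelT t ≡ E) ts

inputDerived? : ∀ ts E → Dec (InputDerived ts E)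
inputDerived? ts E = any? (λ t → isInput? t ×-dec (labelT t ≟ᶜ E)) ts

module _ {A : Set} (P : List A → A → Set) where

  Justified : List A → List A → Set
  Justified pre [] = ⊤
  Justified pre (x ∷ xs) = P pre x × Justified (pre ++ [ x ]) xs

  Justified-++ : ∀ {pre} xs {ys} → Justified pre xs → Justified (pre ++ xs) ys →
                 Justified pre (xs ++ ys)
  Justified-++ {pre} [] {ys} _ jys = subst (λ p → Justified p ys) (++-identityʳ pre) jys
  Justified-++ {pre} (x ∷ xs) {ys} (px , jxs) jys =
    px , Justified-++ xs jxs (subst (λ p → Justified p ys) (sym (++-assoc pre [ x ] xs)) jys)

  Justified-lookup : ∀ {pre} xs → Justified pre xs → (p : Fin (length xs)) →
                     P (pre ++ take (toℕ p) xs) (lookup xs p)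
  Justified-lookup {pre} (x ∷ _) (px , _) zero = subst (λ p → P p x) (sym (++-identityʳ pre)) px
  Justified-lookup {pre} (x ∷ xs) (_ , jxs) (suc p) =
    subst (λ q → P q (lookup xs p)) (++-assoc pre [ x ] (take (toℕ p) xs)) (Justified-lookup xs jxs p)

Any-take⇒lookup : ∀ {A : Set} {Q : A → Set} k (xs : List A) → Any Q (take k xs) →
                  Σ (Fin (length xs)) λ q → toℕ q < k × Q (lookup xs q)
Any-take⇒lookup (suc k) (x ∷ xs) (here qx) = zero , s≤s z≤n , qx
Any-take⇒lookup (suc k) (x ∷ xs) (there a) with Any-take⇒lookup k xs a
... | q , q<k , qx = suc q , s≤s q<k , qx

LeafJustified : List Clause → List Tree → Tree → Set
LeafJustified F pre (tleaf E) = InF F E ⊎ Any (λ t → IsInput t × labelT t ≈ E) pre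
LeafJustified F pre (tnode _ _ _ _) = ⊤

Justified⇒RTI-leaves : ∀ F ts → Justified (LeafJustified F) [] ts →
  ∀ (p : Fin (length ts)) E → lookup ts p ≡ tleaf E →
  InF F E ⊎ (Σ (Fin (length ts)) λ q → q Fin.< p × labelT (lookup ts q) ≈ E × IsInput (lookup ts q))
Justified⇒RTI-leaves F ts J p E ts[p]≡E
  with subst (LeafJustified F (take (toℕ p) ts)) ts[p]≡E (Justified-lookup _ ts J p)
... | inj₁ E∈F = inj₁ E∈F
... | inj₂ earlier with Any-take⇒lookup (toℕ p) ts earlier
...   | q , q<p , input , label = inj₂ (q , q<p , label , input)

updateAt-preserves : ∀ {n} {A : Set} (P : Fin n → A → Set) {xs : Vector A n} i {f : A → A} →
                     (∀ j → P j (xs j)) → P i (f (xs i)) → ∀ j → P j (updateAt xs i f j)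
updateAt-preserves P {xs} i old new j with j ≟ i
... | yes refl = subst (P i) (sym (updateAt-updates i xs)) new
... | no j≢i = subst (P j) (sym (updateAt-minimal j i xs j≢i)) (old j)

≤-updateAt-suc : ∀ {n} (xs : Vector ℕ n) i j → xs j ≤ updateAt xs i suc j
≤-updateAt-suc xs i = updateAt-preserves (λ j k → xs j ≤ k) i (λ _ → ≤-refl) (n≤1+n _)

sum-updateAt-suc : ∀ {n} (xs : Vector ℕ n) i → sum (updateAt xs i suc) ≡ suc (sum xs)
sum-updateAt-suc xs zero = refl
sum-updateAt-suc xs (suc i) = trans (cong (xs zero +_) (sum-updateAt-suc (tail xs) i)) (+-suc _ _)

sum-≤ : ∀ {n} {xs : Vector ℕ n} {B} → (∀ i → xs i ≤ B) → sum xs ≤ n * B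
sum-≤ {zero} _ = z≤n
sum-≤ {suc n} xs≤B = +-mono-≤ (xs≤B zero) (sum-≤ (xs≤B ∘ suc))

2n+1<2[1+k]d : ∀ {n k d} → n ≤ k * d → 1 ≤ d → 2 * n + 1 < 2 * suc k * d
2n+1<2[1+k]d {n} {k} {d} n≤kd 1≤d = begin-strict
  2 * n + 1         <⟨ n<1+n _ ⟩
  suc (2 * n + 1)   ≡⟨ double n ⟩
  2 * (n + 1)       ≤⟨ *-monoʳ-≤ 2 (+-mono-≤ n≤kd 1≤d) ⟩
  2 * (k * d + d)   ≡⟨ factor k d ⟩
  2 * suc k * d     ∎
  where
  open ≤-Reasoning
  double : ∀ n → suc (2 * n + 1) ≡ 2 * (n + 1)
  double = solve-∀
  factor : ∀ k d → 2 * (k * d + d) ≡ 2 * suc k * d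
  factor = solve-∀

module Construction (F : List Clause) (C : Clause) (G : RD F C) where

  M : ℕ
  M = m G

  g : Dag (suc M)
  g = node G

  child₁< : ∀ {v x i j D} → g v ≡ inner x i j D → i Fin.< v
  child₁< e = proj₁ (innerOK G _ _ _ _ _ e)

  child₂< : ∀ {v x i j D} → g v ≡ inner x i j D → j Fin.< v
  child₂< e = proj₁ (proj₂ (innerOK G _ _ _ _ _ e))

  edge₁ : ∀ {v x i j D} → g v ≡ inner x i j D → Edge g i v
  edge₁ e = _ , _ , _ , _ , e , inj₁ refl

  edge₂ : ∀ {v x i j D} → g v ≡ inner x i j D → Edge g j v
  edge₂ e = _ , _ , _ , _ , e , inj₂ refl

  Reaches : Fin (suc M) → Fin (suc M) → Set
  Reaches u v = Σ ℕ (Path g u v)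

  Reaches-step : ∀ {u v w} → Edge g v w → Reaches u v → Reaches u w
  Reaches-step vw (n , uv) = suc n , step uv vw

  isSource? : ∀ w → Dec (IsSource g w)
  isSource? w with g w
  ... | leaf D = yes (D , refl)
  ... | inner _ _ _ _ = no λ { (_ , ()) }

  nodeHeight : (Fin (suc M) → ℕ) → Node (suc M) → ℕ
  nodeHeight _ (leaf _) = 0
  nodeHeight h (inner _ i j _) = suc (h i ⊔ h j)

  -- Agrees with the height on every node of index below k.
  heightWithin : ℕ → Fin (suc M) → ℕ
  heightWithin zero _ = 0
  heightWithin (suc k) v = nodeHeight (heightWithin k) (g v)

  heightWithin-stable : ∀ {k k′} v → toℕ v < k → toℕ v < k′ → heightWithin k v ≡ heightWithin k′ v
  heightWithin-stable {suc k} {suc k′} v (s≤s v≤k) (s≤s v≤k′) with g v in e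
  ... | leaf _ = refl
  ... | inner _ i j _ = cong₂ (λ a b → suc (a ⊔ b))
    (heightWithin-stable i (≤-trans (child₁< e) v≤k) (≤-trans (child₁< e) v≤k′))
    (heightWithin-stable j (≤-trans (child₂< e) v≤k) (≤-trans (child₂< e) v≤k′))

  height : Fin (suc M) → ℕ
  height = heightWithin (suc M)

  height-leaf : ∀ {v D} → g v ≡ leaf D → height v ≡ 0
  height-leaf e = cong (nodeHeight (heightWithin M)) e

  height-inner : ∀ {v x i j D} → g v ≡ inner x i j D → height v ≡ suc (height i ⊔ height j)
  height-inner {v} {i = i} {j} e = trans (cong (nodeHeight (heightWithin M)) e)
    (cong₂ (λ a b → suc (a ⊔ b)) (stable i (child₁< e)) (stable j (child₂< e)))
    where
    stable : ∀ u → u Fin.< v → heightWithin M u ≡ height u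
    stable u u<v = heightWithin-stable u (≤-trans u<v (≤-pred (toℕ<n v))) (toℕ<n u)

  height-child₁ : ∀ {v x i j D} → g v ≡ inner x i j D → height i < height v
  height-child₁ e = subst (_ <_) (sym (height-inner e)) (s≤s (m≤m⊔n _ _))

  height-child₂ : ∀ {v x i j D} → g v ≡ inner x i j D → height j < height v
  height-child₂ e = subst (_ <_) (sym (height-inner e)) (s≤s (m≤n⊔m _ _))

  height-zero : height zero ≡ 0
  height-zero with g zero in e
  ... | leaf _ = refl
  ... | inner _ _ _ _ with child₁< e
  ...   | ()

  height≤0⇒source : ∀ w → height w ≤ 0 → IsSource g w
  height≤0⇒source w h≤0 with g w
  ... | leaf D = D , refl
  ... | inner _ _ _ _ = contradiction h≤0 λ ()

  LongestPathTo : Fin (suc M) → Set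
  LongestPathTo v = Σ (Fin (suc M)) λ u → IsSource g u × Path g u v (height v)

  longestPath : ∀ v → LongestPathTo v
  longestPath = All.wfRec <-wellFounded 0ℓ LongestPathTo go
    where
    extend : ∀ {w v} → LongestPathTo w → Edge g w v → height v ≡ suc (height w) → LongestPathTo v
    extend (u , source , path) wv eq = u , source , subst (Path g u _) (sym eq) (step path wv)
    go : ∀ v → (∀ {w} → w Fin.< v → LongestPathTo w) → LongestPathTo v
    go v rec = through (g v) refl
      where
      through : ∀ nd → g v ≡ nd → LongestPathTo v
      through (leaf D) e = v , (D , e) , subst (Path g v v) (sym (height-leaf e)) here
      through (inner _ i j _) e with ⊔-sel (height i) (height j)
      ... | inj₁ eq = extend (rec (child₁< e)) (edge₁ e) (trans (height-inner e) (cong suc eq))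
      ... | inj₂ eq = extend (rec (child₂< e)) (edge₂ e) (trans (height-inner e) (cong suc eq))

  H : ℕ
  H = height (root G)

  H≤depth : ∀ {d} → IsDepth G (root G) d → H ≤ d
  H≤depth (_ , bound) with longestPath (root G)
  ... | u , source , path = bound u H source path

  data Unfolding : Fin (suc M) → Tree → Set where
    cut    : ∀ {v} → Unfolding v (tleaf (clauseOf (g v)))
    expand : ∀ {v x i j D l r} → g v ≡ inner x i j D →
             Unfolding i l → Unfolding j r → Unfolding v (tnode x D l r)

  Unfolding-label : ∀ {v t} → Unfolding v t → labelT t ≡ clauseOf (g v)
  Unfolding-label cut = refl
  Unfolding-label (expand e _ _) = sym (cong clauseOf e)

  Unfolding-inferences : ∀ {v t} → Unfolding v t → Inferences t
  Unfolding-inferences (expand {v} {x} {i} {j} {D} e l r) =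
    subst₂ (λ A B → Resolves x A B D) (sym (Unfolding-label l)) (sym (Unfolding-label r))
      (proj₂ (proj₂ (proj₂ (innerOK G v x i j D e)))) ,
    Unfolding-inferences l , Unfolding-inferences r
  Unfolding-inferences cut = tt

  Unfolding-noVar : ∀ {y v t} → Unfolding v t →
                    (∀ {w} → Reaches w v → varOf (g w) ≢ just y) → NoVar y t
  Unfolding-noVar cut _ = tt
  Unfolding-noVar (expand e l r) avoid =
    (λ { refl → avoid (0 , here) (cong varOf e) }) ,
    Unfolding-noVar l (avoid ∘ Reaches-step (edge₁ e)) ,
    Unfolding-noVar r (avoid ∘ Reaches-step (edge₂ e))

  Unfolding-regular : RegularRD G → ∀ {v t} → Unfolding v t → RegularT t
  Unfolding-regular _ cut = tt
  Unfolding-regular regular (expand e l r) =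
    Unfolding-noVar l (λ (n , path) x∈w → regular _ _ n _ (step path (edge₁ e)) x∈w (cong varOf e)) ,
    Unfolding-noVar r (λ (n , path) x∈w → regular _ _ n _ (step path (edge₂ e)) x∈w (cong varOf e)) ,
    Unfolding-regular regular l , Unfolding-regular regular r

  Available : List Tree → Fin (suc M) → Set
  Available pre w = InputDerived pre (clauseOf (g w)) ⊎ IsSource g w

  available? : ∀ pre w → Dec (Available pre w)
  available? pre w = inputDerived? pre (clauseOf (g w)) ⊎-dec isSource? w

  Available-++ : ∀ {pre xs w} → Available pre w → Available (pre ++ xs) w
  Available-++ (inj₁ derived) = inj₁ (++⁺ˡ derived)
  Available-++ (inj₂ source) = inj₂ source

  Available⇒LeafJustified : ∀ {pre v} → Available pre v → LeafJustified F pre (tleaf (clauseOf (g v)))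
  Available⇒LeafJustified (inj₁ derived) = inj₂ (Any.map (map₂ ≡⇒≈) derived)
  Available⇒LeafJustified {v = v} (inj₂ (D , e)) = inj₁ (subst (InF F) (sym (cong clauseOf e)) (leafOK G v D e))

  -- counts w: how often w has been unfolded so far
  Counts : Set
  Counts = Vector ℕ (suc M)

  ChildAhead : List Tree → Counts → Fin (suc M) → Fin (suc M) → Set
  ChildAhead pre counts u a = Available pre a ⊎ counts u ≤ counts a

  record Invariant (pre : List Tree) (counts : Counts) : Set where
    field
      count≤height : ∀ w → counts w ≤ height w
      count≤H      : ∀ w → counts w ≤ H
      saturated    : ∀ w → height w ≤ counts w → Available pre w
      children     : ∀ {u x a b E} → g u ≡ inner x a b E →
                     ChildAhead pre counts u a × ChildAhead pre counts u b
  open Invariant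

  Invariant-++ : ∀ {pre xs counts} → Invariant pre counts → Invariant (pre ++ xs) counts
  Invariant-++ {pre} {xs} {counts} inv = record
    { count≤height = count≤height inv
    ; count≤H      = count≤H inv
    ; saturated    = λ w → Available-++ ∘ saturated inv w
    ; children     = λ e → ahead (proj₁ (children inv e)) , ahead (proj₂ (children inv e))
    }
    where
    ahead : ∀ {u a} → ChildAhead pre counts u a → ChildAhead (pre ++ xs) counts u a
    ahead (inj₁ available) = inj₁ (Available-++ available)
    ahead (inj₂ u≤a) = inj₂ u≤a

  ahead⇒available : ∀ {pre counts u a} → Invariant pre counts → height a ≤ counts u →
                    ChildAhead pre counts u a → Available pre a
  ahead⇒available _ _ (inj₁ available) = available
  ahead⇒available inv a≤u (inj₂ u≤a) = saturated inv _ (≤-trans a≤u u≤a)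

  initial-invariant : Invariant [] (λ _ → 0)
  initial-invariant = record
    { count≤height = λ _ → z≤n
    ; count≤H      = λ _ → z≤n
    ; saturated    = λ w h≤0 → inj₂ (height≤0⇒source w h≤0)
    ; children     = λ _ → inj₂ z≤n , inj₂ z≤n
    }

  sum≤M*H : ∀ {pre counts} → Invariant pre counts → sum counts ≤ M * H
  sum≤M*H inv = +-mono-≤ (subst (_ ≤_) height-zero (count≤height inv zero)) (sum-≤ (count≤H inv ∘ suc))

  -- Unfolding v when the trees pre precede it in post-order and c counts the unfoldings so far.
  record Derivation (v : Fin (suc M)) (pre : List Tree) (c : Counts) : Set where
    field
      tree           : Tree
      counts         : Counts
      unfolds        : Unfolding v tree
      justified      : Justified (LeafJustified F) pre (postorder tree)
      invariant      : Invariant (pre ++ postorder tree) counts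
      counts-grow    : ∀ w → c w ≤ counts w
      counts-above   : ∀ w → v Fin.< w → counts w ≡ c w
      available⇒leaf : Available pre v → IsLeaf tree
      progress       : Available pre v ⊎ c v < counts v
      total          : sum counts ≡ internals tree + sum c

  cutDerivation : ∀ {v pre c} → Available pre v → Invariant pre c → Derivation v pre c
  cutDerivation {c = c} available inv = record
    { tree           = tleaf _
    ; counts         = c
    ; unfolds        = cut
    ; justified      = Available⇒LeafJustified available , tt
    ; invariant      = Invariant-++ inv
    ; counts-grow    = λ _ → ≤-refl
    ; counts-above   = λ _ _ → refl
    ; available⇒leaf = λ _ → tt
    ; progress       = inj₁ available
    ; total          = refl
    }

  module Expansion {v pre c} (inv : Invariant pre c) (v≤H : height v ≤ H)
                   (unavailable : ¬ Available pre v) {x i j D} (e : g v ≡ inner x i j D)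
                   (left : Derivation i pre c)
                   (right : Derivation j (pre ++ postorder (Derivation.tree left))
                                         (Derivation.counts left)) where
    private
      module L = Derivation left
      module R = Derivation right

    T : Tree
    T = tnode x D L.tree R.tree

    pre₁ pre₂ pre′ : List Tree
    pre₁ = pre ++ postorder L.tree
    pre₂ = pre₁ ++ postorder R.tree
    pre′ = pre₂ ++ [ T ]

    pre++postorder : pre ++ postorder T ≡ pre′
    pre++postorder = sym (trans (++-assoc pre₁ (postorder R.tree) [ T ])
                                (++-assoc pre (postorder L.tree) (postorder R.tree ++ [ T ])))

    from-pre₂ : ∀ {w} → Available pre₂ w → Available pre′ w
    from-pre₂ = Available-++ {xs = [ T ]}

    from-pre₁ : ∀ {w} → Available pre₁ w → Available pre′ w
    from-pre₁ = from-pre₂ ∘ Available-++ {xs = postorder R.tree}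

    from-pre : ∀ {w} → Available pre w → Available pre′ w
    from-pre = from-pre₁ ∘ Available-++ {xs = postorder L.tree}

    c′ : Counts
    c′ = updateAt R.counts v suc

    R-count-v : R.counts v ≡ c v
    R-count-v = trans (R.counts-above v (child₂< e)) (L.counts-above v (child₁< e))

    c′-v : c′ v ≡ suc (c v)
    c′-v = trans (updateAt-updates v R.counts) (cong suc R-count-v)

    c<height : c v < height v
    c<height = ≰⇒> (unavailable ∘ saturated inv v)

    saturated⇒input : height v ≤ suc (c v) → IsInput T
    saturated⇒input hv≤ = inj₁ i-leaf , IsLeaf⇒IsInput _ i-leaf , IsLeaf⇒IsInput _ j-leaf
      where
      children≤ : height i ⊔ height j ≤ c v
      children≤ = ≤-pred (subst (_≤ suc (c v)) (height-inner e) hv≤)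
      i-leaf : IsLeaf L.tree
      i-leaf = L.available⇒leaf
        (ahead⇒available {u = v} {i} inv (m⊔n≤o⇒m≤o _ _ children≤) (proj₁ (children inv e)))
      j-leaf : IsLeaf R.tree
      j-leaf = R.available⇒leaf (ahead⇒available {u = v} {j} L.invariant
        (subst (_ ≤_) (sym (L.counts-above v (child₁< e))) (m⊔n≤o⇒n≤o _ _ children≤))
        (proj₂ (children L.invariant e)))

    -- A child that was unavailable got unfolded in the meantime, so it keeps up with v.
    ahead-at-v : ∀ a (pre₀ : List Tree) (c₀ c₁ : Counts) →
                 (Available pre₀ a → Available pre′ a) → c₀ v ≡ c v →
                 ChildAhead pre₀ c₀ v a → Available pre₀ a ⊎ c₀ a < c₁ a → c₁ a ≤ c′ a →
                 ChildAhead pre′ c′ v a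
    ahead-at-v _ _ _ _ mono _ (inj₁ available) _ _ = inj₁ (mono available)
    ahead-at-v _ _ _ _ mono _ (inj₂ _) (inj₁ available) _ = inj₁ (mono available)
    ahead-at-v a _ c₀ c₁ _ c₀v≡cv (inj₂ v≤a) (inj₂ a<) c₁a≤ = inj₂ (begin
      c′ v         ≡⟨ c′-v ⟩
      suc (c v)    ≡⟨ cong suc (sym c₀v≡cv) ⟩
      suc (c₀ v)   ≤⟨ s≤s v≤a ⟩
      suc (c₀ a)   ≤⟨ a< ⟩
      c₁ a         ≤⟨ c₁a≤ ⟩
      c′ a         ∎)
      where open ≤-Reasoning

    ahead-elsewhere : ∀ {u a} → u ≢ v → ChildAhead pre₂ R.counts u a → ChildAhead pre′ c′ u a
    ahead-elsewhere _ (inj₁ available) = inj₁ (from-pre₂ available)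
    ahead-elsewhere {u} {a} u≢v (inj₂ u≤a) = inj₂
      (subst (_≤ c′ a) (sym (updateAt-minimal u v R.counts u≢v)) (≤-trans u≤a (≤-updateAt-suc R.counts v a)))

    children′ : ∀ {u y a b E} → g u ≡ inner y a b E → ChildAhead pre′ c′ u a × ChildAhead pre′ c′ u b
    children′ {u} e′ with u ≟ v
    ... | no u≢v = ahead-elsewhere u≢v (proj₁ (children R.invariant e′))
                 , ahead-elsewhere u≢v (proj₂ (children R.invariant e′))
    ... | yes refl with trans (sym e) e′
    ...   | refl = ahead-at-v i pre c L.counts from-pre refl
                     (proj₁ (children inv e)) L.progress
                     (≤-trans (R.counts-grow i) (≤-updateAt-suc R.counts v i))
                 , ahead-at-v j pre₁ L.counts R.counts from-pre₁ (L.counts-above v (child₁< e))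
                     (proj₂ (children L.invariant e)) R.progress (≤-updateAt-suc R.counts v j)

    invariant′ : Invariant pre′ c′
    invariant′ = record
      { count≤height = updateAt-preserves (λ w k → k ≤ height w) v (count≤height R.invariant)
                         (subst (λ k → suc k ≤ height v) (sym R-count-v) c<height)
      ; count≤H      = updateAt-preserves (λ _ k → k ≤ H) v (count≤H R.invariant)
                         (subst (λ k → suc k ≤ H) (sym R-count-v) (≤-trans c<height v≤H))
      ; saturated    = updateAt-preserves (λ w k → height w ≤ k → Available pre′ w) v
                         (λ w → from-pre₂ ∘ saturated R.invariant w)
                         (λ hv≤ → inj₁ (++⁺ʳ pre₂ (here
                           ( saturated⇒input (subst (height v ≤_) (cong suc R-count-v) hv≤)
                           , sym (cong clauseOf e)))))
      ; children     = children′
      }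

    total′ : sum c′ ≡ internals T + sum c
    total′ = begin
      sum c′                                                ≡⟨ sum-updateAt-suc R.counts v ⟩
      suc (sum R.counts)                                    ≡⟨ cong suc R.total ⟩
      suc (internals R.tree + sum L.counts)                 ≡⟨ cong (λ k → suc (internals R.tree + k)) L.total ⟩
      suc (internals R.tree + (internals L.tree + sum c))   ≡⟨ cong suc (sym (+-assoc (internals R.tree) _ _)) ⟩
      suc (internals R.tree + internals L.tree + sum c)     ≡⟨ cong (λ k → suc (k + sum c)) (+-comm (internals R.tree) _) ⟩
      internals T + sum c                                   ∎
      where open ≡-Reasoning

    derivation : Derivation v pre c
    derivation = record
      { tree           = T
      ; counts         = c′
      ; unfolds        = expand e L.unfolds R.unfolds
      ; justified      = Justified-++ _ (postorder L.tree) L.justified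
                           (Justified-++ _ (postorder R.tree) R.justified (tt , tt))
      ; invariant      = subst (λ p → Invariant p c′) (sym pre++postorder) invariant′
      ; counts-grow    = λ w → ≤-trans (L.counts-grow w)
                                 (≤-trans (R.counts-grow w) (≤-updateAt-suc R.counts v w))
      ; counts-above   = λ w v<w → trans (updateAt-minimal w v R.counts (≢-sym (<⇒≢ v<w)))
                           (trans (R.counts-above w (<-trans (child₂< e) v<w))
                                  (L.counts-above w (<-trans (child₁< e) v<w)))
      ; available⇒leaf = ⊥-elim ∘ unavailable
      ; progress       = inj₂ (≤-reflexive (sym c′-v))
      ; total          = total′
      }

  Derivable : Fin (suc M) → Set
  Derivable v = ∀ {pre c} → Invariant pre c → height v ≤ H → Derivation v pre c

  derive : ∀ v → Derivable v
  derive = All.wfRec <-wellFounded 0ℓ Derivable go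
    where
    go : ∀ v → (∀ {u} → u Fin.< v → Derivable u) → Derivable v
    go v rec {pre} {c} inv v≤H with available? pre v
    ... | yes available = cutDerivation available inv
    ... | no unavailable = expandAt (g v) refl
      where
      expandAt : ∀ nd → g v ≡ nd → Derivation v pre c
      expandAt (leaf D) e = contradiction (inj₂ (D , e)) unavailable
      expandAt (inner _ i j _) e = Expansion.derivation inv v≤H unavailable e left right
        where
        left : Derivation i pre c
        left = rec (child₁< e) inv (≤-trans (<⇒≤ (height-child₁ e)) v≤H)
        right : Derivation j (pre ++ postorder (Derivation.tree left)) (Derivation.counts left)
        right = rec (child₂< e) (Derivation.invariant left) (≤-trans (<⇒≤ (height-child₂ e)) v≤H)

theorem3p3 : (F : List Clause) (C : Clause) (G : RD F C) (d : ℕ) →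
    IsDepth G (root G) d → 1 ≤ d →
    Σ Tree λ T → IsRTI F C T × sizeT T < 2 * size G * d ×
      (RegularRD G → RegularT T)
theorem3p3 F C G d depth 1≤d =
  tree , (Unfolding-inferences unfolds , label≈C , Justified⇒RTI-leaves F _ justified) ,
  size-bound , (λ regular → Unfolding-regular regular unfolds)
  where
  open Construction F C G
  open Derivation (derive (root G) initial-invariant ≤-refl)
  open ≤-Reasoning

  label≈C : labelT tree ≈ C
  label≈C = subst (_≈ C) (sym (Unfolding-label unfolds)) (rootOK G)

  internals≤ : internals tree ≤ M * d
  internals≤ = begin
    internals tree                          ≡⟨ sym (+-identityʳ _) ⟩
    internals tree + 0                      ≡⟨ cong (internals tree +_) (sym (sum-replicate-zero (suc M))) ⟩
    internals tree + sum {suc M} (λ _ → 0)  ≡⟨ sym total ⟩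
    sum counts                              ≤⟨ sum≤M*H invariant ⟩
    M * H                                   ≤⟨ *-monoʳ-≤ M (H≤depth depth) ⟩
    M * d                                   ∎

  size-bound : sizeT tree < 2 * size G * d
  size-bound = subst (_< 2 * size G * d) (sym (sizeT≡2*internals+1 tree)) (2n+1<2[1+k]d {k = M} internals≤ 1≤d)
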